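{- For all integers $1\le k<t$, \[ C^*_t(k)\ge\binom{t-1}{k}\max\left(1,\ 2-4\sqrt{2k/t}\right)^k.\]
   Context: For integers $N\ge\omega\ge1$, the Turán graph $T(N,\omega)$ is the complete $\omega$-partite graph on $N$ vertices with part sizes $\lfloor N/\omega\rfloor$ or $\lceil N/\omega\rceil$. For integers $1\le k<t$, $T^*_t(k)$ is the Turán graph $T(2t-\omega-1,\omega)$ maximizing the number of cliques of order $k$ among all $\omega$ with $k\le\omega\le t-1$, and $C^*_t(k)$ is the number of cliques of order $k$ in $T^*_t(k)$. -}

module Defs where

open import Data.Bool using (Bool; true; false; _∧_; if_then_else_)
open import Data.Nat using (ℕ; zero; suc; _+_; _*_; _∸_; _⊔_; _%_; _≡ᵇ_; NonZero)
open import Data.Fin using (Fin; toℕ)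
open import Data.Vec using (Vec; []; _∷_)
open import Data.List using (List; []; _∷_; map; _++_; foldr; length; filter; allFin; upTo)
open import Data.List.Relation.Unary.All using (All)
import Data.List.Relation.Unary.All as All
open import Relation.Nullary.Decidable using (does)
open import Data.Rational using (ℚ; 1ℚ) renaming (_*_ to _*ℚ_)

Graph : ℕ → Set
Graph n = Fin n → Fin n → Bool

-- The parts
-- then have sizes ⌊N/ω⌋ or ⌈N/ω⌉, and the graph is complete ω-partite.
turan : (N ω : ℕ) → .{{_ : NonZero ω}} → Graph N
turan N ω i j = if (toℕ i % ω) ≡ᵇ (toℕ j % ω) then false else true

allSubsets : (n : ℕ) → List (Vec Bool n)
allSubsets zero = [] ∷ []
allSubsets (suc n) = map (true ∷_) (allSubsets n) ++ map (false ∷_) (allSubsets n)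

mem : {n : ℕ} → Vec Bool n → Fin n → Bool
mem (b ∷ _) Fin.zero = b
mem (_ ∷ s) (Fin.suc i) = mem s i
  where import Data.Fin as Fin
size : {n : ℕ} → Vec Bool n → ℕ
size [] = 0
size (true ∷ s) = suc (size s)
size (false ∷ s) = size s

andAll : List Bool → Bool
andAll = foldr _∧_ true

isClique : {n : ℕ} → Graph n → Vec Bool n → Bool
isClique {n} G S =
  andAll (map (λ i → andAll (map (λ j →
    if mem S i ∧ mem S j ∧ Data.Bool.not (toℕ i ≡ᵇ toℕ j) then G i j else true)
    (allFin n))) (allFin n))
  where import Data.Bool

cliqueCount : {n : ℕ} → Graph n → ℕ → ℕ
cliqueCount {n} G k =
  length (filter (λ S → Data.Bool._≟_ ((size S ≡ᵇ k) ∧ isClique G S) true) (allSubsets n))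
  where import Data.Bool

-- Number of k-cliques of the Turán graph T(2t − ω − 1, ω) for ω ≥ 1
-- (given as ω = suc w).
turanCliques : (t w k : ℕ) → ℕ
turanCliques t w k = cliqueCount (turan (2 * t ∸ suc w ∸ 1) (suc w)) k

-- C*_t(k) = max over k ≤ ω ≤ t − 1 of the number of k-cliques of
-- T(2t − ω − 1, ω).  (For k ≥ 1 every such ω is ≥ 1.)
-- The list ranges over ω = k + i for i = 0, …, (t − 1 − k).
Cstar : (t k : ℕ) → ℕ
Cstar t k = foldr _⊔_ 0
  (map (λ i → turanCliques t (k + i ∸ 1) k) (upTo (suc (t ∸ 1 ∸ k))))

_^ℚ_ : ℚ → ℕ → ℚ
q ^ℚ zero = 1ℚ
q ^ℚ suc n = q *ℚ (q ^ℚ n)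

{-# OPTIONS --safe #-}
-- Colour each vertex of the Turán graph T(N, ω) by its part. A k-clique is a set of k
-- vertices of distinct colours, so if every part has at least m vertices, T(N, ω) has at
-- least e_k(m, …, m) = C(ω, k) m^k cliques of order k; this is proved by removing one
-- vertex at a time while recording the colours already used. For r = p/q take
-- ω = x ≈ (2 − r) t / 4 and m = ⌊(2t − x − 1) / x⌋, so that every part of
-- T(2t − x − 1, x) has at least m vertices. The hypothesis 32k ≤ t (2 − r)² gives
-- (t − 1 − i) r ≤ (x − i) m for every i < k, and the product of these k inequalities is
-- C(t − 1, k) r^k ≤ C(x, k) m^k ≤ C*_t(k). The first bound is the case x = t − 1, m = 1.
module Submission where

open import Defs
open import Data.Nat
  using (ℕ; zero; suc; pred; _+_; _*_; _∸_; _^_; _≤_; _<_; _≡ᵇ_; _%_; _⊔_; z≤n; s≤s; NonZero; >-nonZero)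
open import Data.Nat.Properties
open import Data.Nat.DivMod using (_div_; m%n<n; m<n⇒m%n≡m; [m+n]%n≡m%n; m≡m%n+[m/n]*n; m/n*n≤m)
open import Data.Nat.Combinatorics using (_C_; nC1≡n; nCk+nC[k+1]≡[n+1]C[k+1])
open import Data.Nat.Tactic.RingSolver using (solve-∀)
import Data.Nat.Coprimality as Coprime
open import Data.Bool using (Bool; true; false; _∧_; _∨_; not; if_then_else_)
import Data.Bool as Bool
open import Data.Bool.Properties
  using (∧-zeroʳ; ∧-conicalˡ; ∧-conicalʳ; ∨-zeroʳ; ∨-identityʳ; ∨-conicalˡ; ∨-conicalʳ; not-injective; ⇔→≡)
open import Data.Fin as Fin using (Fin; toℕ)
open import Data.Fin.Properties using (toℕ-injective) renaming (suc-injective to Fin-suc-injective)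
open import Data.Vec using (Vec; []; _∷_)
open import Data.List using (List; []; _∷_; map; _++_; foldr; length; filter; allFin)
open import Data.List.Membership.Propositional using (_∈_)
open import Data.List.Membership.Propositional.Properties using (∈-allFin; ∈-map⁺; ∈-upTo⁺)
open import Data.List.Relation.Unary.Any using (here; there)
open import Data.Product using (_×_; _,_; proj₁; proj₂; ∃₂)
open import Data.Empty using (⊥-elim)
open import Data.Integer using (+_)
import Data.Integer as ℤ
import Data.Integer.Properties as ℤ
open import Data.Rational using (ℚ; 1ℚ; _-_; _/_; mkℚ; toℚᵘ)
  renaming (_≤_ to _≤ℚ_; _*_ to _*ℚ_; -_ to -ℚ_)
open import Data.Rational.Properties
  using (normalize-coprime; toℚᵘ-mono-≤; toℚᵘ-cancel-≤; toℚᵘ-homo-*; toℚᵘ-homo-+; toℚᵘ-homo‿-)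
open import Data.Rational.Unnormalised using (mkℚᵘ; *≤*; *≡*)
  renaming (_≤_ to _≤ᵘ_; _≃_ to _≃ᵘ_; _+_ to _+ᵘ_; _*_ to _*ᵘ_; -_ to -ᵘ_)
import Data.Rational.Unnormalised.Properties as ℚᵘ
open import Function using (_∘_; mk⇔)
open import Relation.Binary.PropositionalEquality
open import Relation.Nullary using (yes; no; contradiction)
open import Relation.Nullary.Decidable using (dec-true; dec-false)

count : {A : Set} → (A → Bool) → List A → ℕ
count p [] = 0
count p (x ∷ xs) = (if p x then 1 else 0) + count p xs

length-filter≡count : {A : Set} (p : A → Bool) (xs : List A) →
  length (filter (λ x → p x Bool.≟ true) xs) ≡ count p xs
length-filter≡count p [] = refl
length-filter≡count p (x ∷ xs) with p x
... | true = cong suc (length-filter≡count p xs)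
... | false = length-filter≡count p xs

count-cong : {A : Set} {p q : A → Bool} → (∀ x → p x ≡ q x) → (xs : List A) → count p xs ≡ count q xs
count-cong p≗q [] = refl
count-cong p≗q (x ∷ xs) = cong₂ (λ b n → (if b then 1 else 0) + n) (p≗q x) (count-cong p≗q xs)

count-++ : {A : Set} (p : A → Bool) (xs ys : List A) → count p (xs ++ ys) ≡ count p xs + count p ys
count-++ p [] ys = refl
count-++ p (x ∷ xs) ys = trans (cong (_+_ (if p x then 1 else 0)) (count-++ p xs ys))
  (sym (+-assoc (if p x then 1 else 0) _ _))

count-map : {A B : Set} (p : B → Bool) (f : A → B) (xs : List A) → count p (map f xs) ≡ count (p ∘ f) xs
count-map p f [] = refl
count-map p f (x ∷ xs) = cong (_+_ (if p (f x) then 1 else 0)) (count-map p f xs)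

count-false : {A : Set} (xs : List A) → count (λ _ → false) xs ≡ 0
count-false [] = refl
count-false (x ∷ xs) = count-false xs

-- Cliques of colour graphs

≡ᵇ-refl : ∀ m → (m ≡ᵇ m) ≡ true
≡ᵇ-refl m = dec-true (m ≟ m) refl

≢⇒≡ᵇ-false : ∀ {m n} → m ≢ n → (m ≡ᵇ n) ≡ false
≢⇒≡ᵇ-false {m} {n} = dec-false (m ≟ n)

≡ᵇ-false⇒≢ : ∀ {m n} → (m ≡ᵇ n) ≡ false → m ≢ n
≡ᵇ-false⇒≢ {m} m≡ᵇn refl with trans (sym m≡ᵇn) (≡ᵇ-refl m)
... | ()

colourGraph : ∀ {n} → (ℕ → ℕ) → Graph n
colourGraph c i j = if c (toℕ i) ≡ᵇ c (toℕ j) then false else true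

Clique : ∀ {n} → Graph n → Vec Bool n → Set
Clique G S = ∀ i j → mem S i ≡ true → mem S j ≡ true → i ≢ j → G i j ≡ true

andAll-map⁻ : {A : Set} (f : A → Bool) (xs : List A) →
  andAll (map f xs) ≡ true → ∀ {x} → x ∈ xs → f x ≡ true
andAll-map⁻ f (y ∷ ys) all (here refl) = ∧-conicalˡ _ _ all
andAll-map⁻ f (y ∷ ys) all (there x∈ys) = andAll-map⁻ f ys (∧-conicalʳ (f y) _ all) x∈ys

andAll-map⁺ : {A : Set} (f : A → Bool) (xs : List A) →
  (∀ {x} → x ∈ xs → f x ≡ true) → andAll (map f xs) ≡ true
andAll-map⁺ f [] all = refl
andAll-map⁺ f (y ∷ ys) all = cong₂ _∧_ (all (here refl)) (andAll-map⁺ f ys (all ∘ there))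

if-then-true : ∀ {b x} → (b ≡ true → x ≡ true) → (if b then x else true) ≡ true
if-then-true {true} x≡true = x≡true refl
if-then-true {false} _ = refl

isClique⇒Clique : ∀ {n} (G : Graph n) S → isClique G S ≡ true → Clique G S
isClique⇒Clique {n} G S isC i j i∈S j∈S i≢j = subst (λ b → (if b then G i j else true) ≡ true) guard entry
  where
  entry = andAll-map⁻ _ (allFin n) (andAll-map⁻ _ (allFin n) isC (∈-allFin i)) (∈-allFin j)
  guard : mem S i ∧ mem S j ∧ not (toℕ i ≡ᵇ toℕ j) ≡ true
  guard = cong₂ _∧_ i∈S (cong₂ _∧_ j∈S (cong not (≢⇒≡ᵇ-false (i≢j ∘ toℕ-injective))))

Clique⇒isClique : ∀ {n} (G : Graph n) S → Clique G S → isClique G S ≡ true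
Clique⇒isClique {n} G S clique = andAll-map⁺ _ (allFin n) λ {i} _ → andAll-map⁺ _ (allFin n) λ {j} _ →
  if-then-true λ guard →
    let j∈S,i≢j = ∧-conicalʳ (mem S i) _ guard in
    clique i j (∧-conicalˡ _ _ guard) (∧-conicalˡ _ _ j∈S,i≢j)
      (≡ᵇ-false⇒≢ (not-injective (∧-conicalʳ (mem S j) _ j∈S,i≢j)) ∘ cong toℕ)

forbid : (ℕ → Bool) → ℕ → ℕ → Bool
forbid F b a = F a ∨ (a ≡ᵇ b)

-- Vertex j has colour c j; F is the set of colours already used.
rainbow : ∀ {n} → (ℕ → ℕ) → (ℕ → Bool) → Vec Bool n → Bool
rainbow c F [] = true
rainbow c F (true ∷ S) = not (F (c 0)) ∧ rainbow (c ∘ suc) (forbid F (c 0)) S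
rainbow c F (false ∷ S) = rainbow (c ∘ suc) F S

Rainbow : ∀ {n} → (ℕ → ℕ) → (ℕ → Bool) → Vec Bool n → Set
Rainbow c F S = (∀ i → mem S i ≡ true → F (c (toℕ i)) ≡ false)
  × (∀ i j → mem S i ≡ true → mem S j ≡ true → i ≢ j → c (toℕ i) ≢ c (toℕ j))

rainbow⇒Rainbow : ∀ {n} c F (S : Vec Bool n) → rainbow c F S ≡ true → Rainbow c F S
rainbow⇒Rainbow c F [] _ = (λ ()) , (λ ())
rainbow⇒Rainbow c F (false ∷ S) rb = allowed , distinct
  where
  ih = rainbow⇒Rainbow (c ∘ suc) F S rb
  allowed : ∀ i → mem (false ∷ S) i ≡ true → F (c (toℕ i)) ≡ false
  allowed (Fin.suc i) = proj₁ ih i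
  distinct : ∀ i j → mem (false ∷ S) i ≡ true → mem (false ∷ S) j ≡ true → i ≢ j → c (toℕ i) ≢ c (toℕ j)
  distinct (Fin.suc i) (Fin.suc j) i∈S j∈S i≢j = proj₂ ih i j i∈S j∈S (i≢j ∘ cong Fin.suc)
rainbow⇒Rainbow c F (true ∷ S) rb = allowed , distinct
  where
  ih = rainbow⇒Rainbow (c ∘ suc) (forbid F (c 0)) S (∧-conicalʳ (not (F (c 0))) _ rb)
  allowed : ∀ i → mem (true ∷ S) i ≡ true → F (c (toℕ i)) ≡ false
  allowed Fin.zero _ = not-injective (∧-conicalˡ _ _ rb)
  allowed (Fin.suc i) i∈S = ∨-conicalˡ _ _ (proj₁ ih i i∈S)
  differs : ∀ i → mem S i ≡ true → c (suc (toℕ i)) ≢ c 0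
  differs i i∈S = ≡ᵇ-false⇒≢ (∨-conicalʳ _ _ (proj₁ ih i i∈S))
  distinct : ∀ i j → mem (true ∷ S) i ≡ true → mem (true ∷ S) j ≡ true → i ≢ j → c (toℕ i) ≢ c (toℕ j)
  distinct Fin.zero Fin.zero _ _ i≢j = ⊥-elim (i≢j refl)
  distinct Fin.zero (Fin.suc j) _ j∈S _ = differs j j∈S ∘ sym
  distinct (Fin.suc i) Fin.zero i∈S _ _ = differs i i∈S
  distinct (Fin.suc i) (Fin.suc j) i∈S j∈S i≢j = proj₂ ih i j i∈S j∈S (i≢j ∘ cong Fin.suc)

Rainbow⇒rainbow : ∀ {n} c F (S : Vec Bool n) → Rainbow c F S → rainbow c F S ≡ true
Rainbow⇒rainbow c F [] _ = refl
Rainbow⇒rainbow c F (false ∷ S) (allowed , distinct) =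
  Rainbow⇒rainbow (c ∘ suc) F S
    (allowed ∘ Fin.suc , λ i j i∈S j∈S i≢j → distinct (Fin.suc i) (Fin.suc j) i∈S j∈S (i≢j ∘ Fin-suc-injective))
Rainbow⇒rainbow c F (true ∷ S) (allowed , distinct) =
  cong₂ _∧_ (cong not (allowed Fin.zero refl))
    (Rainbow⇒rainbow (c ∘ suc) (forbid F (c 0)) S
      ((λ i i∈S → cong₂ _∨_ (allowed (Fin.suc i) i∈S)
                    (≢⇒≡ᵇ-false (distinct (Fin.suc i) Fin.zero i∈S refl λ ()))) ,
       λ i j i∈S j∈S i≢j → distinct (Fin.suc i) (Fin.suc j) i∈S j∈S (i≢j ∘ Fin-suc-injective)))

isClique-colourGraph : ∀ {n} c (S : Vec Bool n) → isClique (colourGraph c) S ≡ rainbow c (λ _ → false) S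
isClique-colourGraph c S = ⇔→≡ (mk⇔
  (λ isC → Rainbow⇒rainbow c _ S ((λ _ _ → refl) , λ i j i∈S j∈S i≢j →
     colourGraph-adjacent c i j (isClique⇒Clique (colourGraph c) S isC i j i∈S j∈S i≢j)))
  (λ rb → Clique⇒isClique (colourGraph c) S λ i j i∈S j∈S i≢j →
     cong (λ b → if b then false else true) (≢⇒≡ᵇ-false (proj₂ (rainbow⇒Rainbow c _ S rb) i j i∈S j∈S i≢j))))
  where
  colourGraph-adjacent : ∀ {n} c (i j : Fin n) → colourGraph c i j ≡ true → c (toℕ i) ≢ c (toℕ j)
  colourGraph-adjacent c i j adj with c (toℕ i) ≡ᵇ c (toℕ j) in eq
  ... | false = ≡ᵇ-false⇒≢ eq

rainbowCount : ℕ → (ℕ → ℕ) → (ℕ → Bool) → ℕ → ℕ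
rainbowCount n c F k = count (λ S → (size S ≡ᵇ k) ∧ rainbow c F S) (allSubsets n)

cliqueCount-colourGraph : ∀ n c k → cliqueCount (colourGraph {n} c) k ≡ rainbowCount n c (λ _ → false) k
cliqueCount-colourGraph n c k = trans (length-filter≡count _ (allSubsets n))
  (count-cong (λ S → cong ((size S ≡ᵇ k) ∧_) (isClique-colourGraph c S)) (allSubsets n))

rainbowCount-split : ∀ n c F k → rainbowCount (suc n) c F k ≡
  count (λ S → (suc (size S) ≡ᵇ k) ∧ rainbow c F (true ∷ S)) (allSubsets n) + rainbowCount n (c ∘ suc) F k
rainbowCount-split n c F k = trans (count-++ _ (map (true ∷_) (allSubsets n)) (map (false ∷_) (allSubsets n)))
  (cong₂ _+_ (count-map _ (true ∷_) (allSubsets n)) (count-map _ (false ∷_) (allSubsets n)))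

rainbowCount-zero : ∀ n c F → 1 ≤ rainbowCount n c F 0
rainbowCount-zero zero c F = ≤-refl
rainbowCount-zero (suc n) c F = ≤-trans (rainbowCount-zero n (c ∘ suc) F)
  (≤-trans (m≤n+m _ _) (≤-reflexive (sym (rainbowCount-split n c F 0))))

rainbowCount-forbidden : ∀ n c F k → F (c 0) ≡ true →
  rainbowCount (suc n) c F (suc k) ≡ rainbowCount n (c ∘ suc) F (suc k)
rainbowCount-forbidden n c F k c0∈F rewrite rainbowCount-split n c F (suc k) | c0∈F =
  cong (_+ rainbowCount n (c ∘ suc) F (suc k))
    (trans (count-cong (λ S → ∧-zeroʳ (size S ≡ᵇ k)) (allSubsets n)) (count-false (allSubsets n)))

rainbowCount-allowed : ∀ n c F k → F (c 0) ≡ false → rainbowCount (suc n) c F (suc k) ≡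
  rainbowCount n (c ∘ suc) (forbid F (c 0)) k + rainbowCount n (c ∘ suc) F (suc k)
rainbowCount-allowed n c F k c0∉F rewrite rainbowCount-split n c F (suc k) | c0∉F = refl

-- Binomial coefficients

-- The form without ∸ makes the inductive step a semiring identity.
[k+1]*nC[k+1]+k*nCk≡n*nCk : ∀ n k → suc k * (n C suc k) + k * (n C k) ≡ n * (n C k)
[k+1]*nC[k+1]+k*nCk≡n*nCk n zero =
  trans (+-identityʳ _) (trans (*-identityˡ _) (trans (nC1≡n n) (sym (*-identityʳ n))))
[k+1]*nC[k+1]+k*nCk≡n*nCk zero (suc k) = cong₂ _+_ (*-zeroʳ (suc (suc k))) (*-zeroʳ (suc k))
[k+1]*nC[k+1]+k*nCk≡n*nCk (suc n) (suc k) = begin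
  suc (suc k) * (suc n C suc (suc k)) + suc k * (suc n C suc k)
    ≡⟨ cong₂ (λ x y → suc (suc k) * x + suc k * y)
             (nCk+nC[k+1]≡[n+1]C[k+1] n (suc k)) (nCk+nC[k+1]≡[n+1]C[k+1] n k) ⟨
  suc (suc k) * (B + B′) + suc k * (A + B)
    ≡⟨ regroup₁ k A B B′ ⟩
  suc (suc k) * B + (suc (suc k) * B′ + suc k * B) + suc k * A
    ≡⟨ cong (λ x → suc (suc k) * B + x + suc k * A) ([k+1]*nC[k+1]+k*nCk≡n*nCk n (suc k)) ⟩
  suc (suc k) * B + n * B + suc k * A
    ≡⟨ regroup₂ k n A B ⟩
  B + n * B + A + (suc k * B + k * A)
    ≡⟨ cong (_+_ (B + n * B + A)) ([k+1]*nC[k+1]+k*nCk≡n*nCk n k) ⟩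
  B + n * B + A + n * A
    ≡⟨ regroup₃ n A B ⟩
  suc n * (A + B)
    ≡⟨ cong (suc n *_) (nCk+nC[k+1]≡[n+1]C[k+1] n k) ⟩
  suc n * (suc n C suc k) ∎
  where
  open ≡-Reasoning
  A = n C k
  B = n C suc k
  B′ = n C suc (suc k)
  regroup₁ : ∀ k A B B′ → suc (suc k) * (B + B′) + suc k * (A + B) ≡
                          suc (suc k) * B + (suc (suc k) * B′ + suc k * B) + suc k * A
  regroup₁ = solve-∀
  regroup₂ : ∀ k n A B → suc (suc k) * B + n * B + suc k * A ≡ B + n * B + A + (suc k * B + k * A)
  regroup₂ = solve-∀
  regroup₃ : ∀ n A B → B + n * B + A + n * A ≡ suc n * (A + B)
  regroup₃ = solve-∀

[n∸k]*nCk≡[k+1]*nC[k+1] : ∀ n k → (n ∸ k) * (n C k) ≡ suc k * (n C suc k)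
[n∸k]*nCk≡[k+1]*nC[k+1] n k = begin
  (n ∸ k) * (n C k)                                ≡⟨ *-distribʳ-∸ (n C k) n k ⟩
  n * (n C k) ∸ k * (n C k)                        ≡⟨ cong (_∸ k * (n C k)) ([k+1]*nC[k+1]+k*nCk≡n*nCk n k) ⟨
  suc k * (n C suc k) + k * (n C k) ∸ k * (n C k)  ≡⟨ m+n∸n≡m (suc k * (n C suc k)) (k * (n C k)) ⟩
  suc k * (n C suc k)                              ∎
  where open ≡-Reasoning

aCk*P^k≤bCk*Q^k : ∀ a b P Q k → (∀ i → i < k → (a ∸ i) * P ≤ (b ∸ i) * Q) →
  (a C k) * P ^ k ≤ (b C k) * Q ^ k
aCk*P^k≤bCk*Q^k a b P Q zero _ = ≤-refl
aCk*P^k≤bCk*Q^k a b P Q (suc k) factorwise = *-cancelˡ-≤ (suc k) (begin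
  suc k * ((a C suc k) * (P * P ^ k)) ≡⟨ factor a P ⟩
  ((a ∸ k) * P) * ((a C k) * P ^ k)
    ≤⟨ *-mono-≤ (factorwise k ≤-refl) (aCk*P^k≤bCk*Q^k a b P Q k (λ i i<k → factorwise i (m<n⇒m<1+n i<k))) ⟩
  ((b ∸ k) * Q) * ((b C k) * Q ^ k) ≡⟨ factor b Q ⟨
  suc k * ((b C suc k) * (Q * Q ^ k)) ∎)
  where
  open ≤-Reasoning
  factor : ∀ a P → suc k * ((a C suc k) * (P * P ^ k)) ≡ ((a ∸ k) * P) * ((a C k) * P ^ k)
  factor a P = begin-equality
    suc k * ((a C suc k) * (P * P ^ k))   ≡⟨ *-assoc (suc k) (a C suc k) (P * P ^ k) ⟨
    (suc k * (a C suc k)) * (P * P ^ k)   ≡⟨ cong (_* (P * P ^ k)) ([n∸k]*nCk≡[k+1]*nC[k+1] a k) ⟨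
    ((a ∸ k) * (a C k)) * (P * P ^ k)     ≡⟨ interchange (a ∸ k) (a C k) P (P ^ k) ⟩
    ((a ∸ k) * P) * ((a C k) * P ^ k)     ∎
    where
    interchange : ∀ x y z w → (x * y) * (z * w) ≡ (x * z) * (y * w)
    interchange = solve-∀

-- Elementary symmetric polynomials

-- elemSym ω k v = e_k (v 0, …, v (ω ∸ 1))
elemSym : ℕ → ℕ → (ℕ → ℕ) → ℕ
elemSym ω zero v = 1
elemSym zero (suc k) v = 0
elemSym (suc ω) (suc k) v = v ω * elemSym ω k v + elemSym ω (suc k) v

elemSym-cong : ∀ ω k {u v} → (∀ a → a < ω → u a ≡ v a) → elemSym ω k u ≡ elemSym ω k v
elemSym-cong ω zero _ = refl
elemSym-cong zero (suc k) _ = refl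
elemSym-cong (suc ω) (suc k) u≗v = cong₂ _+_
  (cong₂ _*_ (u≗v ω ≤-refl) (elemSym-cong ω k (λ a a<ω → u≗v a (m<n⇒m<1+n a<ω))))
  (elemSym-cong ω (suc k) (λ a a<ω → u≗v a (m<n⇒m<1+n a<ω)))

elemSym-mono : ∀ ω k {u v} → (∀ a → a < ω → u a ≤ v a) → elemSym ω k u ≤ elemSym ω k v
elemSym-mono ω zero _ = ≤-refl
elemSym-mono zero (suc k) _ = ≤-refl
elemSym-mono (suc ω) (suc k) u≤v = +-mono-≤
  (*-mono-≤ (u≤v ω ≤-refl) (elemSym-mono ω k (λ a a<ω → u≤v a (m<n⇒m<1+n a<ω))))
  (elemSym-mono ω (suc k) (λ a a<ω → u≤v a (m<n⇒m<1+n a<ω)))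

elemSym-const : ∀ ω k m → elemSym ω k (λ _ → m) ≡ (ω C k) * m ^ k
elemSym-const ω zero m = refl
elemSym-const zero (suc k) m = refl
elemSym-const (suc ω) (suc k) m = begin
  m * elemSym ω k (λ _ → m) + elemSym ω (suc k) (λ _ → m)
    ≡⟨ cong₂ (λ x y → m * x + y) (elemSym-const ω k m) (elemSym-const ω (suc k) m) ⟩
  m * ((ω C k) * m ^ k) + (ω C suc k) * (m * m ^ k)  ≡⟨ collect m (ω C k) (ω C suc k) (m ^ k) ⟩
  (ω C k + ω C suc k) * (m * m ^ k)              ≡⟨ cong (_* (m * m ^ k)) (nCk+nC[k+1]≡[n+1]C[k+1] ω k) ⟩
  (suc ω C suc k) * (m * m ^ k) ∎
  where
  open ≡-Reasoning
  collect : ∀ m A B P → m * (A * P) + B * (m * P) ≡ (A + B) * (m * P)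
  collect = solve-∀

elemSym-vanishingLast : ∀ ω k u → u ω ≡ 0 → elemSym (suc ω) k u ≡ elemSym ω k u
elemSym-vanishingLast ω zero u _ = refl
elemSym-vanishingLast ω (suc k) u uω≡0 rewrite uω≡0 = refl

elemSym-extract : ∀ ω k a {u v} → a < ω → (∀ b → b ≢ a → v b ≡ u b) → u a ≡ 0 →
  elemSym ω (suc k) v ≡ elemSym ω (suc k) u + v a * elemSym ω k u
elemSym-extract (suc ω) k a {u} {v} a<1+ω v≗u ua≡0 with a ≟ ω
... | yes refl rewrite ua≡0 | elemSym-vanishingLast a k u ua≡0 =
  trans (cong₂ (λ x y → v a * x + y) (elemSym-cong a k below) (elemSym-cong a (suc k) below))
        (+-comm (v a * elemSym a k u) _)
  where
  below : ∀ b → b < a → v b ≡ u b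
  below b b<a = v≗u b (<⇒≢ b<a)
... | no a≢ω = extract k
  where
  a<ω : a < ω
  a<ω = ≤∧≢⇒< (≤-pred a<1+ω) a≢ω
  vω≡uω : v ω ≡ u ω
  vω≡uω = v≗u ω (a≢ω ∘ sym)
  extract : ∀ k → elemSym (suc ω) (suc k) v ≡ elemSym (suc ω) (suc k) u + v a * elemSym (suc ω) k u
  extract zero rewrite elemSym-extract ω zero a a<ω v≗u ua≡0 | vω≡uω = regroup₀ (u ω) (elemSym ω 1 u) (v a)
    where
    regroup₀ : ∀ x e₁ y → x * 1 + (e₁ + y * 1) ≡ (x * 1 + e₁) + y * 1
    regroup₀ = solve-∀
  extract (suc k) rewrite elemSym-extract ω (suc k) a a<ω v≗u ua≡0 | elemSym-extract ω k a a<ω v≗u ua≡0 | vω≡uω =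
    regroup (u ω) (elemSym ω k u) (elemSym ω (suc k) u) (elemSym ω (suc (suc k)) u) (v a)
    where
    regroup : ∀ x e₀ e₁ e₂ y → x * (e₁ + y * e₀) + (e₂ + y * e₁) ≡ (x * e₁ + e₂) + y * (x * e₀ + e₁)
    regroup = solve-∀

elemSym-incrementAt : ∀ ω k a {u v v′} → a < ω →
  (∀ b → b ≢ a → v b ≡ u b) → (∀ b → b ≢ a → v′ b ≡ u b) → u a ≡ 0 → v a ≡ suc (v′ a) →
  elemSym ω (suc k) v ≡ elemSym ω (suc k) v′ + elemSym ω k u
elemSym-incrementAt ω k a {u} {v} {v′} a<ω v≗u v′≗u ua≡0 va≡1+v′a = begin
  elemSym ω (suc k) v                     ≡⟨ elemSym-extract ω k a a<ω v≗u ua≡0 ⟩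
  eₖ₊₁ + v a * eₖ                         ≡⟨ cong (λ x → eₖ₊₁ + x * eₖ) va≡1+v′a ⟩
  eₖ₊₁ + (eₖ + v′ a * eₖ)                 ≡⟨ swap eₖ₊₁ eₖ (v′ a * eₖ) ⟩
  (eₖ₊₁ + v′ a * eₖ) + eₖ                 ≡⟨ cong (_+ eₖ) (elemSym-extract ω k a a<ω v′≗u ua≡0) ⟨
  elemSym ω (suc k) v′ + elemSym ω k u    ∎
  where
  open ≡-Reasoning
  eₖ = elemSym ω k u
  eₖ₊₁ = elemSym ω (suc k) u
  swap : ∀ x y z → x + (y + z) ≡ (x + z) + y
  swap = solve-∀

-- Colour classes

occurrences : ℕ → (ℕ → ℕ) → ℕ → ℕ
occurrences zero c a = 0
occurrences (suc n) c a = (if c 0 ≡ᵇ a then 1 else 0) + occurrences n (c ∘ suc) a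

occurrences-first : ∀ n c → occurrences (suc n) c (c 0) ≡ suc (occurrences n (c ∘ suc) (c 0))
occurrences-first n c rewrite ≡ᵇ-refl (c 0) = refl

occurrences-≢first : ∀ n c {a} → c 0 ≢ a → occurrences (suc n) c a ≡ occurrences n (c ∘ suc) a
occurrences-≢first n c c0≢a rewrite ≢⇒≡ᵇ-false c0≢a = refl

allowedSize : ℕ → (ℕ → ℕ) → (ℕ → Bool) → ℕ → ℕ
allowedSize n c F a = if F a then 0 else occurrences n c a

allowedSize-empty : ∀ c F a → allowedSize 0 c F a ≡ 0
allowedSize-empty c F a with F a
... | true = refl
... | false = refl

allowedSize-≢first : ∀ n c F {a} → c 0 ≢ a → allowedSize (suc n) c F a ≡ allowedSize n (c ∘ suc) F a
allowedSize-≢first n c F c0≢a = cong (if _ then 0 else_) (occurrences-≢first n c c0≢a)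

allowedSize-first : ∀ n c F → F (c 0) ≡ false →
  allowedSize (suc n) c F (c 0) ≡ suc (allowedSize n (c ∘ suc) F (c 0))
allowedSize-first n c F allowed rewrite allowed = occurrences-first n c

allowedSize-forbiddenFirst : ∀ n c F a → F (c 0) ≡ true →
  allowedSize (suc n) c F a ≡ allowedSize n (c ∘ suc) F a
allowedSize-forbiddenFirst n c F a forbidden with c 0 ≟ a
... | yes refl rewrite forbidden = refl
... | no c0≢a = allowedSize-≢first n c F c0≢a

allowedSize-forbid : ∀ n c F b → allowedSize n c (forbid F b) b ≡ 0
allowedSize-forbid n c F b rewrite ≡ᵇ-refl b | ∨-zeroʳ (F b) = refl

allowedSize-forbid-≢ : ∀ n c F {a b} → a ≢ b → allowedSize n c F a ≡ allowedSize n c (forbid F b) a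
allowedSize-forbid-≢ n c F {a} a≢b rewrite ≢⇒≡ᵇ-false a≢b | ∨-identityʳ (F a) = refl

elemSym≤rainbowCount : ∀ ω n c F k → (∀ j → c j < ω) →
  elemSym ω k (allowedSize n c F) ≤ rainbowCount n c F k
elemSym≤rainbowCount ω n c F zero _ = rainbowCount-zero n c F
elemSym≤rainbowCount ω zero c F (suc k) _ = ≤-reflexive (begin-equality
  elemSym ω (suc k) (allowedSize 0 c F) ≡⟨ elemSym-cong ω (suc k) (λ a _ → allowedSize-empty c F a) ⟩
  elemSym ω (suc k) (λ _ → 0)            ≡⟨ elemSym-const ω (suc k) 0 ⟩
  (ω C suc k) * 0                        ≡⟨ *-zeroʳ (ω C suc k) ⟩
  0 ∎)
  where open ≤-Reasoning
elemSym≤rainbowCount ω (suc n) c F (suc k) c<ω with F (c 0) in c0∈F?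
... | true = begin
  elemSym ω (suc k) (allowedSize (suc n) c F)
    ≡⟨ elemSym-cong ω (suc k) (λ a _ → allowedSize-forbiddenFirst n c F a c0∈F?) ⟩
  elemSym ω (suc k) (allowedSize n (c ∘ suc) F)
    ≤⟨ elemSym≤rainbowCount ω n (c ∘ suc) F (suc k) (c<ω ∘ suc) ⟩
  rainbowCount n (c ∘ suc) F (suc k)
    ≡⟨ rainbowCount-forbidden n c F k c0∈F? ⟨
  rainbowCount (suc n) c F (suc k) ∎
  where open ≤-Reasoning
... | false = begin
  elemSym ω (suc k) (allowedSize (suc n) c F)
    ≡⟨ elemSym-incrementAt ω k (c 0) (c<ω 0)
         (λ b b≢c0 → trans (allowedSize-≢first n c F (b≢c0 ∘ sym)) (allowedSize-forbid-≢ n (c ∘ suc) F b≢c0))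
         (λ b b≢c0 → allowedSize-forbid-≢ n (c ∘ suc) F b≢c0)
         (allowedSize-forbid n (c ∘ suc) F (c 0))
         (allowedSize-first n c F c0∈F?) ⟩
  elemSym ω (suc k) (allowedSize n (c ∘ suc) F) + elemSym ω k (allowedSize n (c ∘ suc) (forbid F (c 0)))
    ≤⟨ +-mono-≤ (elemSym≤rainbowCount ω n (c ∘ suc) F (suc k) (c<ω ∘ suc))
                (elemSym≤rainbowCount ω n (c ∘ suc) (forbid F (c 0)) k (c<ω ∘ suc)) ⟩
  rainbowCount n (c ∘ suc) F (suc k) + rainbowCount n (c ∘ suc) (forbid F (c 0)) k
    ≡⟨ +-comm (rainbowCount n (c ∘ suc) F (suc k)) _ ⟩
  rainbowCount n (c ∘ suc) (forbid F (c 0)) k + rainbowCount n (c ∘ suc) F (suc k)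
    ≡⟨ rainbowCount-allowed n c F k c0∈F? ⟨
  rainbowCount (suc n) c F (suc k) ∎
  where open ≤-Reasoning

-- Turán graphs

occurrences-++ : ∀ m n c a → occurrences (m + n) c a ≡ occurrences m c a + occurrences n (c ∘ _+_ m) a
occurrences-++ zero n c a = refl
occurrences-++ (suc m) n c a = trans (cong (_+_ (if c 0 ≡ᵇ a then 1 else 0)) (occurrences-++ m n (c ∘ suc) a))
  (sym (+-assoc (if c 0 ≡ᵇ a then 1 else 0) _ _))

occurrences-cong : ∀ n {c d} a → (∀ j → c j ≡ d j) → occurrences n c a ≡ occurrences n d a
occurrences-cong zero a _ = refl
occurrences-cong (suc n) a c≗d =
  cong₂ (λ x y → (if x ≡ᵇ a then 1 else 0) + y) (c≗d 0) (occurrences-cong n a (c≗d ∘ suc))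

occurrences-mono : ∀ {m n} c a → m ≤ n → occurrences m c a ≤ occurrences n c a
occurrences-mono {m} {n} c a m≤n = begin
  occurrences m c a                                          ≤⟨ m≤m+n _ _ ⟩
  occurrences m c a + occurrences (n ∸ m) (c ∘ _+_ m) a    ≡⟨ occurrences-++ m (n ∸ m) c a ⟨
  occurrences (m + (n ∸ m)) c a                              ≡⟨ cong (λ n → occurrences n c a) (m+[n∸m]≡n m≤n) ⟩
  occurrences n c a ∎
  where open ≤-Reasoning

occurrences-pos : ∀ {n} c {a} j → j < n → c j ≡ a → 1 ≤ occurrences n c a
occurrences-pos {suc n} c zero _ refl rewrite ≡ᵇ-refl (c 0) = s≤s z≤n
occurrences-pos {suc n} c (suc j) (s≤s j<n) cj≡a = ≤-trans (occurrences-pos (c ∘ suc) j j<n cj≡a) (m≤n+m _ _)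

occurrences-mod : ∀ m ω .{{_ : NonZero ω}} {a} → a < ω → m ≤ occurrences (m * ω) (_% ω) a
occurrences-mod zero ω a<ω = z≤n
occurrences-mod (suc m) ω {a} a<ω = begin
  1 + m
    ≤⟨ +-mono-≤ (occurrences-pos (_% ω) a a<ω (m<n⇒m%n≡m a<ω)) (occurrences-mod m ω a<ω) ⟩
  occurrences ω (_% ω) a + occurrences (m * ω) (_% ω) a
    ≡⟨ cong (_+_ (occurrences ω (_% ω) a)) (occurrences-cong (m * ω) a (λ j → sym ([ω+j]%ω≡j%ω j))) ⟩
  occurrences ω (_% ω) a + occurrences (m * ω) (λ j → (ω + j) % ω) a
    ≡⟨ occurrences-++ ω (m * ω) (_% ω) a ⟨
  occurrences (suc m * ω) (_% ω) a ∎
  where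
  open ≤-Reasoning
  [ω+j]%ω≡j%ω : ∀ j → (ω + j) % ω ≡ j % ω
  [ω+j]%ω≡j%ω j = trans (cong (_% ω) (+-comm ω j)) ([m+n]%n≡m%n j ω)

ωCk*m^k≤cliqueCount-turan : ∀ N ω m k .{{_ : NonZero ω}} → m * ω ≤ N →
  (ω C k) * m ^ k ≤ cliqueCount (turan N ω) k
ωCk*m^k≤cliqueCount-turan N ω m k mω≤N = begin
  (ω C k) * m ^ k
    ≡⟨ elemSym-const ω k m ⟨
  elemSym ω k (λ _ → m)
    ≤⟨ elemSym-mono ω k (λ a a<ω → ≤-trans (occurrences-mod m ω a<ω) (occurrences-mono (_% ω) a mω≤N)) ⟩
  elemSym ω k (allowedSize N (_% ω) (λ _ → false))
    ≤⟨ elemSym≤rainbowCount ω N (_% ω) (λ _ → false) k (λ j → m%n<n j ω) ⟩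
  rainbowCount N (_% ω) (λ _ → false) k
    ≡⟨ cliqueCount-colourGraph N (_% ω) k ⟨
  cliqueCount (turan N ω) k ∎
  where open ≤-Reasoning

foldr-⊔-upperBound : ∀ {y} ys → y ∈ ys → y ≤ foldr _⊔_ 0 ys
foldr-⊔-upperBound (y ∷ ys) (here refl) = m≤m⊔n y _
foldr-⊔-upperBound (z ∷ zs) (there y∈zs) = ≤-trans (foldr-⊔-upperBound zs y∈zs) (m≤n⊔m z _)

xCk*m^k≤Cstar : ∀ t k x m → 1 ≤ k → k ≤ x → x ≤ t ∸ 1 → m * x ≤ 2 * t ∸ x ∸ 1 →
  (x C k) * m ^ k ≤ Cstar t k
xCk*m^k≤Cstar t (suc k) zero m _ () _ _
xCk*m^k≤Cstar t k (suc w) m _ k≤x x≤t-1 mx≤N = begin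
  (suc w C k) * m ^ k                ≤⟨ ωCk*m^k≤cliqueCount-turan (2 * t ∸ suc w ∸ 1) (suc w) m k mx≤N ⟩
  turanCliques t w k                 ≡⟨ cong (λ ω → turanCliques t (ω ∸ 1) k) (m+[n∸m]≡n k≤x) ⟨
  turanCliques t (k + i ∸ 1) k       ≤⟨ foldr-⊔-upperBound _ (∈-map⁺ (λ i → turanCliques t (k + i ∸ 1) k) (∈-upTo⁺ i<1+[t∸1∸k])) ⟩
  Cstar t k ∎
  where
  open ≤-Reasoning
  i = suc w ∸ k
  i<1+[t∸1∸k] : i < suc (t ∸ 1 ∸ k)
  i<1+[t∸1∸k] = s≤s (∸-monoˡ-≤ k x≤t-1)

[t∸1]Ck≤Cstar : ∀ k t → 1 ≤ k → k < t → (t ∸ 1) C k ≤ Cstar t k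
[t∸1]Ck≤Cstar k t 1≤k k<t = begin
  (t ∸ 1) C k              ≡⟨ *-identityʳ _ ⟨
  ((t ∸ 1) C k) * 1        ≡⟨ cong (((t ∸ 1) C k) *_) (^-zeroˡ k) ⟨
  ((t ∸ 1) C k) * 1 ^ k    ≤⟨ xCk*m^k≤Cstar t k (t ∸ 1) 1 1≤k (∸-monoˡ-≤ 1 k<t) ≤-refl t∸1≤N ⟩
  Cstar t k                ∎
  where
  open ≤-Reasoning
  t∸1≤N : 1 * (t ∸ 1) ≤ 2 * t ∸ (t ∸ 1) ∸ 1
  t∸1≤N = begin
    1 * (t ∸ 1)            ≡⟨ *-identityˡ (t ∸ 1) ⟩
    t ∸ 1                  ≤⟨ m∸n≤m t 1 ⟩
    t                      ≡⟨ +-identityʳ t ⟨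
    t + 0                  ≡⟨ m+n∸m≡n t (t + 0) ⟨
    2 * t ∸ t              ≡⟨ cong (2 * t ∸_) (m∸n+n≡m (≤-trans (s≤s z≤n) k<t)) ⟨
    2 * t ∸ (t ∸ 1 + 1)    ≡⟨ ∸-+-assoc (2 * t) (t ∸ 1) 1 ⟨
    2 * t ∸ (t ∸ 1) ∸ 1    ∎

-- Choice of the Turán graph

m<[m/n]*n+n : ∀ m n .{{_ : NonZero n}} → m < m div n * n + n
m<[m/n]*n+n m n = begin-strict
  m                    ≡⟨ m≡m%n+[m/n]*n m n ⟩
  m % n + m div n * n  <⟨ +-monoˡ-< (m div n * n) (m%n<n m n) ⟩
  n + m div n * n      ≡⟨ +-comm n (m div n * n) ⟩
  m div n * n + n      ∎
  where open ≤-Reasoning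

ey+2e²k+16q²k≤e²t : ∀ e q y k t → e ≤ q → y ≤ 4 * q → 1 ≤ k → 32 * k * (q * q) ≤ t * (e * e) →
  e * y + 2 * (e * e) * k + 16 * (q * q) * k ≤ (e * e) * t
ey+2e²k+16q²k≤e²t e q y k t e≤q y≤4q 1≤k 32kq²≤te² = *-cancelˡ-≤ 32 (begin
  32 * (e * y + 2 * (e * e) * k + 16 * (q * q) * k)
    ≤⟨ *-monoʳ-≤ 32 (+-monoˡ-≤ _ (+-mono-≤ ey≤4q²k (*-monoˡ-≤ k (*-monoʳ-≤ 2 (*-mono-≤ e≤q e≤q))))) ⟩
  32 * (k * (4 * (q * q)) + 2 * (q * q) * k + 16 * (q * q) * k)
    ≡⟨ collect k q ⟩
  22 * (32 * k * (q * q))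
    ≤⟨ *-mono-≤ (m≤m+n 22 10) 32kq²≤te² ⟩
  32 * (t * (e * e))
    ≡⟨ cong (32 *_) (*-comm t (e * e)) ⟩
  32 * ((e * e) * t) ∎)
  where
  open ≤-Reasoning
  collect : ∀ k q → 32 * (k * (4 * (q * q)) + 2 * (q * q) * k + 16 * (q * q) * k) ≡ 22 * (32 * k * (q * q))
  collect = solve-∀
  ey≤4q²k : e * y ≤ k * (4 * (q * q))
  ey≤4q²k = begin
    e * y              ≤⟨ *-mono-≤ e≤q y≤4q ⟩
    q * (4 * q)        ≡⟨ *-identityˡ _ ⟨
    1 * (q * (4 * q))  ≤⟨ *-mono-≤ 1≤k (≤-reflexive (rotate q)) ⟩
    k * (4 * (q * q))  ∎
    where
    rotate : ∀ q → q * (4 * q) ≡ 4 * (q * q)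
    rotate = solve-∀

2qx²+2qkt≤exw : ∀ e q x y k w t → 1 ≤ e → 1 ≤ q → k + w ≡ t → 4 * q * x ≡ e * t + y →
  e * y + 2 * (e * e) * k + 16 * (q * q) * k ≤ (e * e) * t →
  2 * q * (x * x) + 2 * q * k * t ≤ e * x * w
2qx²+2qkt≤exw e@(suc _) q@(suc _) x y k w .(k + w) _ _ refl X≡et+y errors≤e²t = *-cancelˡ-≤ (8 * q) (begin
  8 * q * (2 * q * (x * x) + 2 * q * k * t)  ≡⟨ scale q x k t ⟩
  X * X + 16 * (q * q) * k * t               ≤⟨ X²+16q²kt≤2ewX ⟩
  2 * e * w * X                              ≡⟨ unscale q x e w ⟩
  8 * q * (e * x * w) ∎)
  where
  open ≤-Reasoning
  t = k + w
  X = 4 * q * x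
  scale : ∀ q x k t → 8 * q * (2 * q * (x * x) + 2 * q * k * t) ≡ 4 * q * x * (4 * q * x) + 16 * (q * q) * k * t
  scale = solve-∀
  unscale : ∀ q x e w → 2 * e * w * (4 * q * x) ≡ 8 * q * (e * x * w)
  unscale = solve-∀
  e²t+ey+16q²k≤2e²w : e * e * t + e * y + 16 * (q * q) * k ≤ 2 * (e * e) * w
  e²t+ey+16q²k≤2e²w = +-cancelʳ-≤ (2 * (e * e) * k) _ _ (begin
    (e * e * t + e * y + 16 * (q * q) * k) + 2 * (e * e) * k
      ≡⟨ shuffle (e * e) t (e * y) (16 * (q * q) * k) (2 * (e * e) * k) ⟩
    e * e * t + (e * y + 2 * (e * e) * k + 16 * (q * q) * k) ≤⟨ +-monoʳ-≤ (e * e * t) errors≤e²t ⟩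
    e * e * t + (e * e) * t                                  ≡⟨ double (e * e) k w ⟩
    2 * (e * e) * w + 2 * (e * e) * k ∎)
    where
    shuffle : ∀ a b c d f → (a * b + c + d) + f ≡ a * b + (c + f + d)
    shuffle = solve-∀
    double : ∀ a k w → a * (k + w) + a * (k + w) ≡ 2 * a * w + 2 * a * k
    double = solve-∀
  et≤X : e * t ≤ X
  et≤X = ≤-trans (m≤m+n (e * t) y) (≤-reflexive (sym X≡et+y))
  X²+16q²kt≤2ewX : X * X + 16 * (q * q) * k * t ≤ 2 * e * w * X
  X²+16q²kt≤2ewX = *-cancelˡ-≤ e (begin
    e * (X * X + 16 * (q * q) * k * t)                   ≡⟨ expand e X (16 * (q * q) * k) t ⟩
    X * (e * X) + 16 * (q * q) * k * (e * t)
      ≡⟨ cong (λ z → X * (e * z) + 16 * (q * q) * k * (e * t)) X≡et+y ⟩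
    X * (e * (e * t + y)) + 16 * (q * q) * k * (e * t)
      ≤⟨ +-monoʳ-≤ (X * (e * (e * t + y))) (*-monoʳ-≤ (16 * (q * q) * k) et≤X) ⟩
    X * (e * (e * t + y)) + 16 * (q * q) * k * X          ≡⟨ factor X e t y (16 * (q * q) * k) ⟩
    X * (e * e * t + e * y + 16 * (q * q) * k)            ≤⟨ *-monoʳ-≤ X e²t+ey+16q²k≤2e²w ⟩
    X * (2 * (e * e) * w)                                 ≡⟨ rotate X e w ⟩
    e * (2 * e * w * X) ∎)
    where
    expand : ∀ e X c t → e * (X * X + c * t) ≡ X * (e * X) + c * (e * t)
    expand = solve-∀
    factor : ∀ X e t y c → X * (e * (e * t + y)) + c * X ≡ X * (e * e * t + e * y + c)
    factor = solve-∀
    rotate : ∀ X e w → X * (2 * (e * e) * w) ≡ e * (2 * e * w * X)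
    rotate = solve-∀

-- After multiplying by x: x u p = 2 q x u − x u e, and x v m q ≥ 2 q v (t − x) since m x ≥ 2 (t − x).
u*p≤v*[m*q] : ∀ u v i x t m q p e → x ≡ v + i → t ≡ u + 1 + i → p + e ≡ 2 * q → 1 ≤ x →
  2 * t ≤ m * x + 2 * x → 2 * q * i * u + 2 * q * (v * v) ≤ x * u * e → u * p ≤ v * (m * q)
u*p≤v*[m*q] u v i .(v + i) .(u + 1 + i) m q p e refl refl p+e≡2q 1≤x 2t≤mx+2x quadratic =
  *-cancelˡ-≤ x {{>-nonZero 1≤x}} (≤-trans (m≤m+n (x * (u * p)) (2 * v * q))
   (+-cancelʳ-≤ (x * u * e + 2 * v * q * x) _ _ (begin
    (x * (u * p) + 2 * v * q) + (x * u * e + 2 * v * q * x) ≡⟨ collect x u p e v q ⟩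
    x * u * (p + e) + 2 * v * q * x + 2 * v * q
      ≡⟨ cong (λ z → x * u * z + 2 * v * q * x + 2 * v * q) p+e≡2q ⟩
    x * u * (2 * q) + 2 * v * q * x + 2 * v * q            ≡⟨ split v i u q ⟩
    v * q * (2 * (u + 1 + i)) + (2 * q * i * u + 2 * q * (v * v))
      ≤⟨ +-mono-≤ (*-monoʳ-≤ (v * q) 2t≤mx+2x) quadratic ⟩
    v * q * (m * x + 2 * x) + x * u * e                    ≡⟨ regroup v q m x u e ⟩
    x * (v * (m * q)) + (x * u * e + 2 * v * q * x) ∎)))
  where
  open ≤-Reasoning
  x = v + i
  collect : ∀ x u p e v q → (x * (u * p) + 2 * v * q) + (x * u * e + 2 * v * q * x) ≡
                            x * u * (p + e) + 2 * v * q * x + 2 * v * q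
  collect = solve-∀
  split : ∀ v i u q → (v + i) * u * (2 * q) + 2 * v * q * (v + i) + 2 * v * q ≡
                      v * q * (2 * (u + 1 + i)) + (2 * q * i * u + 2 * q * (v * v))
  split = solve-∀
  regroup : ∀ v q m x u e → v * q * (m * x + 2 * x) + x * u * e ≡
                            x * (v * (m * q)) + (x * u * e + 2 * v * q * x)
  regroup = solve-∀

[t∸1∸i]*p≤[x∸i]*[m*q] : ∀ {k t x p q e} m i → i < k → k ≤ x → x < t → p + e ≡ 2 * q → 2 * t ≤ m * x + 2 * x →
  2 * q * (x * x) + 2 * q * k * t ≤ e * x * (t ∸ k) → (t ∸ 1 ∸ i) * p ≤ (x ∸ i) * (m * q)
[t∸1∸i]*p≤[x∸i]*[m*q] {k} {t} {x} {p} {q} {e} m i i<k k≤x x<t p+e≡2q 2t≤mx+2x quadratic =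
  u*p≤v*[m*q] u v i x t m q p e x≡v+i t≡u+1+i p+e≡2q (≤-trans (s≤s z≤n) (<-≤-trans i<k k≤x)) 2t≤mx+2x (begin
    2 * q * i * u + 2 * q * (v * v)  ≤⟨ +-mono-≤ (*-mono-≤ (*-monoʳ-≤ (2 * q) (<⇒≤ i<k)) u≤t)
                                                  (*-monoʳ-≤ (2 * q) (*-mono-≤ (m∸n≤m x i) (m∸n≤m x i))) ⟩
    2 * q * k * t + 2 * q * (x * x)  ≡⟨ +-comm (2 * q * k * t) _ ⟩
    2 * q * (x * x) + 2 * q * k * t  ≤⟨ quadratic ⟩
    e * x * (t ∸ k)                  ≤⟨ *-monoʳ-≤ (e * x) t∸k≤u ⟩
    e * x * u                        ≡⟨ rotate e x u ⟩
    x * u * e                        ∎)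
  where
  open ≤-Reasoning
  u = t ∸ 1 ∸ i
  v = x ∸ i
  x≡v+i : x ≡ v + i
  x≡v+i = sym (m∸n+n≡m (≤-trans (<⇒≤ i<k) k≤x))
  i<t : i < t
  i<t = <-≤-trans i<k (≤-trans k≤x (<⇒≤ x<t))
  t≡u+1+i : t ≡ u + 1 + i
  t≡u+1+i = sym (begin-equality
    u + 1 + i    ≡⟨ +-assoc u 1 i ⟩
    u + (1 + i)  ≡⟨ cong (_+_ u) (+-comm 1 i) ⟩
    u + (i + 1)  ≡⟨ +-assoc u i 1 ⟨
    u + i + 1    ≡⟨ cong (_+ 1) (m∸n+n≡m (∸-monoˡ-≤ 1 i<t)) ⟩
    t ∸ 1 + 1    ≡⟨ m∸n+n≡m (≤-trans (s≤s z≤n) i<t) ⟩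
    t ∎)
  u≤t : u ≤ t
  u≤t = ≤-trans (m∸n≤m (t ∸ 1) i) (m∸n≤m t 1)
  t∸k≤u : t ∸ k ≤ u
  t∸k≤u = ≤-trans (∸-monoʳ-≤ t i<k) (≤-reflexive (sym (∸-+-assoc t 1 i)))
  rotate : ∀ e x u → e * x * u ≡ x * u * e
  rotate = solve-∀

e≤q : ∀ {p q e} → p + e ≡ 2 * q → q ≤ p → e ≤ q
e≤q {p} {q} {e} p+e≡2q q≤p = +-cancelˡ-≤ q e q (begin
  q + e      ≤⟨ +-monoˡ-≤ e q≤p ⟩
  p + e      ≡⟨ p+e≡2q ⟩
  2 * q      ≡⟨ cong (_+_ q) (+-identityʳ q) ⟩
  q + q      ∎)
  where open ≤-Reasoning

x-range : ∀ k t q e x → 1 ≤ k → 1 ≤ q → e ≤ q → 32 * k * (q * q) ≤ t * (e * e) →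
  e * t ≤ 4 * q * x → 4 * q * x ≤ e * t + 4 * q → k ≤ x × x < t
x-range k t q@(suc _) e x 1≤k _ e≤q 32kq²≤te² et≤4qx 4qx≤et+4q = k≤x , x<t
  where
  open ≤-Reasoning
  32k≤t : 32 * k ≤ t
  32k≤t = *-cancelʳ-≤ (32 * k) t (q * q) (≤-trans 32kq²≤te² (*-monoʳ-≤ t (*-mono-≤ e≤q e≤q)))
  32kq≤te : 32 * k * q ≤ t * e
  32kq≤te = *-cancelʳ-≤ (32 * k * q) (t * e) q (begin
    32 * k * q * q    ≡⟨ *-assoc (32 * k) q q ⟩
    32 * k * (q * q)  ≤⟨ 32kq²≤te² ⟩
    t * (e * e)       ≤⟨ *-monoʳ-≤ t (*-monoʳ-≤ e e≤q) ⟩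
    t * (e * q)       ≡⟨ *-assoc t e q ⟨
    t * e * q         ∎)
  k≤x : k ≤ x
  k≤x = *-cancelˡ-≤ (4 * q) (begin
    4 * q * k     ≡⟨ rotate q k ⟩
    4 * (k * q)   ≤⟨ *-monoˡ-≤ (k * q) (m≤m+n 4 28) ⟩
    32 * (k * q)  ≡⟨ *-assoc 32 k q ⟨
    32 * k * q    ≤⟨ 32kq≤te ⟩
    t * e         ≡⟨ *-comm t e ⟩
    e * t         ≤⟨ et≤4qx ⟩
    4 * q * x     ∎)
    where
    rotate : ∀ q k → 4 * q * k ≡ 4 * (k * q)
    rotate = solve-∀
  8≤3t : 8 ≤ 3 * t
  8≤3t = ≤-trans (m≤m+n 8 88) (*-monoʳ-≤ 3 (≤-trans (m≤m*n 32 k {{>-nonZero 1≤k}}) 32k≤t))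
  x<t : x < t
  x<t = *-cancelˡ-≤ (4 * q) (begin
    4 * q * suc x            ≡⟨ *-suc (4 * q) x ⟩
    4 * q + 4 * q * x        ≤⟨ +-monoʳ-≤ (4 * q) 4qx≤et+4q ⟩
    4 * q + (e * t + 4 * q)  ≤⟨ +-monoʳ-≤ (4 * q) (+-monoˡ-≤ (4 * q) (*-monoˡ-≤ t e≤q)) ⟩
    4 * q + (q * t + 4 * q)  ≡⟨ collect q t ⟩
    q * t + q * 8            ≤⟨ +-monoʳ-≤ (q * t) (*-monoʳ-≤ q 8≤3t) ⟩
    q * t + q * (3 * t)      ≡⟨ collect′ q t ⟩
    4 * q * t                ∎)
    where
    collect : ∀ q t → 4 * q + (q * t + 4 * q) ≡ q * t + q * 8
    collect = solve-∀
    collect′ : ∀ q t → q * t + q * (3 * t) ≡ 4 * q * t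
    collect′ = solve-∀

2t≤[N/x]*x+2x : ∀ t x .{{_ : NonZero x}} → x < t → 2 * t ≤ (2 * t ∸ x ∸ 1) div x * x + 2 * x
2t≤[N/x]*x+2x t x x<t = begin
  2 * t                    ≡⟨ m∸n+n≡m (≤-trans x<t (m≤m+n t (t + 0))) ⟨
  2 * t ∸ suc x + suc x    ≡⟨ cong (λ n → 2 * t ∸ n + suc x) (+-comm x 1) ⟨
  2 * t ∸ (x + 1) + suc x  ≡⟨ cong (_+ suc x) (∸-+-assoc (2 * t) x 1) ⟨
  N + suc x                ≡⟨ +-suc N x ⟩
  suc N + x                ≤⟨ +-monoˡ-≤ x (m<[m/n]*n+n N x) ⟩
  N div x * x + x + x      ≡⟨ +-assoc (N div x * x) x x ⟩
  N div x * x + (x + x)    ≡⟨ cong (λ n → N div x * x + (x + n)) (+-identityʳ x) ⟨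
  N div x * x + 2 * x      ∎
  where
  open ≤-Reasoning
  N = 2 * t ∸ x ∸ 1

1≤e : ∀ {k t q e} → 1 ≤ k → 1 ≤ q → 32 * k * (q * q) ≤ t * (e * e) → 1 ≤ e
1≤e {e = suc _} _ _ _ = s≤s z≤n
1≤e {k} {t} {q} {zero} 1≤k 1≤q 32kq²≤t0 = contradiction 32≤0 λ ()
  where
  32≤0 : 32 ≤ 0
  32≤0 = ≤-trans (*-mono-≤ (*-monoʳ-≤ 32 1≤k) (*-mono-≤ 1≤q 1≤q)) (≤-trans 32kq²≤t0 (≤-reflexive (*-zeroʳ t)))

-- With r = p / q we have e / q = 2 − r, so the x chosen below is about (2 − r) t / 4.
turanParameters : ∀ k t p q e → 1 ≤ k → k < t → 1 ≤ q → p + e ≡ 2 * q → q ≤ p →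
  32 * k * (q * q) ≤ t * (e * e) →
  ∃₂ λ x m → k ≤ x × x ≤ t ∸ 1 × m * x ≤ 2 * t ∸ x ∸ 1 ×
             (∀ i → i < k → (t ∸ 1 ∸ i) * p ≤ (x ∸ i) * (m * q))
turanParameters k t p q@(suc _) e 1≤k k<t 1≤q p+e≡2q q≤p 32kq²≤te² =
  x , m , k≤x , ∸-monoˡ-≤ 1 x<t , m/n*n≤m N x ,
  λ i i<k → [t∸1∸i]*p≤[x∸i]*[m*q] m i i<k k≤x x<t p+e≡2q (2t≤[N/x]*x+2x t x x<t) quadratic
  where
  x = suc (e * t div (4 * q))
  4qx≡[et/4q]*4q+4q : 4 * q * x ≡ e * t div (4 * q) * (4 * q) + 4 * q
  4qx≡[et/4q]*4q+4q = trans (*-suc (4 * q) _) (trans (+-comm (4 * q) _) (cong (_+ 4 * q) (*-comm (4 * q) _)))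
  et≤4qx : e * t ≤ 4 * q * x
  et≤4qx = ≤-trans (<⇒≤ (m<[m/n]*n+n (e * t) (4 * q))) (≤-reflexive (sym 4qx≡[et/4q]*4q+4q))
  4qx≤et+4q : 4 * q * x ≤ e * t + 4 * q
  4qx≤et+4q = ≤-trans (≤-reflexive 4qx≡[et/4q]*4q+4q) (+-monoˡ-≤ (4 * q) (m/n*n≤m (e * t) (4 * q)))
  x-bounds = x-range k t q e x 1≤k 1≤q (e≤q p+e≡2q q≤p) 32kq²≤te² et≤4qx 4qx≤et+4q
  k≤x = proj₁ x-bounds
  x<t = proj₂ x-bounds
  N = 2 * t ∸ x ∸ 1
  m = N div x
  y = 4 * q * x ∸ e * t
  y≤4q : y ≤ 4 * q
  y≤4q = ≤-trans (∸-monoˡ-≤ (e * t) 4qx≤et+4q) (≤-reflexive (m+n∸m≡n (e * t) (4 * q)))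
  quadratic : 2 * q * (x * x) + 2 * q * k * t ≤ e * x * (t ∸ k)
  quadratic = 2qx²+2qkt≤exw e q x y k (t ∸ k) t (1≤e {t = t} 1≤k 1≤q 32kq²≤te²) 1≤q
    (m+[n∸m]≡n (<⇒≤ k<t)) (sym (m+[n∸m]≡n et≤4qx))
    (ey+2e²k+16q²k≤e²t e q y k t (e≤q p+e≡2q q≤p) y≤4q 1≤k 32kq²≤te²)

[m*n]^k≡m^k*n^k : ∀ m n k → (m * n) ^ k ≡ m ^ k * n ^ k
[m*n]^k≡m^k*n^k m n zero = refl
[m*n]^k≡m^k*n^k m n (suc k) = trans (cong (m * n *_) ([m*n]^k≡m^k*n^k m n k)) (interchange m n (m ^ k) (n ^ k))
  where
  interchange : ∀ a b c d → a * b * (c * d) ≡ a * c * (b * d)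
  interchange = solve-∀

[t∸1]Ck*p^k≤Cstar*q^k : ∀ k t → 1 ≤ k → k < t → ∀ p q → 1 ≤ q → q ≤ p → p ≤ 2 * q →
  32 * k * (q * q) ≤ t * ((2 * q ∸ p) * (2 * q ∸ p)) → ((t ∸ 1) C k) * p ^ k ≤ Cstar t k * q ^ k
[t∸1]Ck*p^k≤Cstar*q^k k t 1≤k k<t p q 1≤q q≤p p≤2q 32kq²≤te²
  with x , m , k≤x , x≤t-1 , mx≤N , factorwise
       ← turanParameters k t p q (2 * q ∸ p) 1≤k k<t 1≤q (m+[n∸m]≡n p≤2q) q≤p 32kq²≤te² = begin
  ((t ∸ 1) C k) * p ^ k      ≤⟨ aCk*P^k≤bCk*Q^k (t ∸ 1) x p (m * q) k factorwise ⟩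
  (x C k) * (m * q) ^ k      ≡⟨ cong ((x C k) *_) ([m*n]^k≡m^k*n^k m q k) ⟩
  (x C k) * (m ^ k * q ^ k)  ≡⟨ *-assoc (x C k) (m ^ k) (q ^ k) ⟨
  (x C k) * m ^ k * q ^ k    ≤⟨ *-monoˡ-≤ (q ^ k) (xCk*m^k≤Cstar t k x m 1≤k k≤x x≤t-1 mx≤N) ⟩
  Cstar t k * q ^ k          ∎
  where open ≤-Reasoning

-- Rationals

mkℚᵘ-≤⁺ : ∀ a b c d → a * suc d ≤ c * suc b → mkℚᵘ (+ a) b ≤ᵘ mkℚᵘ (+ c) d
mkℚᵘ-≤⁺ a b c d ad≤cb = *≤* (subst₂ ℤ._≤_ (ℤ.pos-* a (suc d)) (ℤ.pos-* c (suc b)) (ℤ.+≤+ ad≤cb))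

mkℚᵘ-≤⁻ : ∀ a b c d → mkℚᵘ (+ a) b ≤ᵘ mkℚᵘ (+ c) d → a * suc d ≤ c * suc b
mkℚᵘ-≤⁻ a b c d (*≤* ad≤cb) with subst₂ ℤ._≤_ (sym (ℤ.pos-* a (suc d))) (sym (ℤ.pos-* c (suc b))) ad≤cb
... | ℤ.+≤+ ad≤cb = ad≤cb

mkℚᵘ-* : ∀ a b c d → mkℚᵘ (+ a) b *ᵘ mkℚᵘ (+ c) d ≃ᵘ mkℚᵘ (+ (a * c)) (d + b * suc d)
mkℚᵘ-* a b c d = *≡* (cong (ℤ._* + suc (d + b * suc d)) (sym (ℤ.pos-* a c)))

toℚᵘ-fromℕ : ∀ n → toℚᵘ (+ n / 1) ≡ mkℚᵘ (+ n) 0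
toℚᵘ-fromℕ n = cong toℚᵘ (normalize-coprime (Coprime.sym (Coprime.1-coprimeTo n)))

toℚᵘ-^ : ∀ r p d → toℚᵘ r ≃ᵘ mkℚᵘ (+ p) d →
  ∀ k → toℚᵘ (r ^ℚ k) ≃ᵘ mkℚᵘ (+ (p ^ k)) (pred (suc d ^ k))
toℚᵘ-^ r p d r≃p/q zero = ℚᵘ.≃-refl
toℚᵘ-^ r p d r≃p/q (suc k) = begin
  toℚᵘ (r *ℚ (r ^ℚ k))                                   ≈⟨ toℚᵘ-homo-* r (r ^ℚ k) ⟩
  toℚᵘ r *ᵘ toℚᵘ (r ^ℚ k)                                ≈⟨ ℚᵘ.*-cong r≃p/q (toℚᵘ-^ r p d r≃p/q k) ⟩
  mkℚᵘ (+ p) d *ᵘ mkℚᵘ (+ (p ^ k)) (pred (q ^ k))        ≈⟨ mkℚᵘ-* p d (p ^ k) (pred (q ^ k)) ⟩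
  mkℚᵘ (+ (p ^ suc k)) (pred (q ^ k) + d * suc (pred (q ^ k)))
    ≡⟨ cong (mkℚᵘ (+ (p ^ suc k))) denominator ⟩
  mkℚᵘ (+ (p ^ suc k)) (pred (q ^ suc k)) ∎
  where
  open ℚᵘ.≃-Reasoning
  q = suc d
  instance _ = m^n≢0 q k
  denominator : pred (q ^ k) + d * suc (pred (q ^ k)) ≡ pred (q ^ suc k)
  denominator = cong (λ n → pred (n + d * n)) (suc-pred (q ^ k))

toℚᵘ-2- : ∀ r p d → toℚᵘ r ≃ᵘ mkℚᵘ (+ p) d → p ≤ 2 * suc d →
  toℚᵘ (+ 2 / 1 - r) ≃ᵘ mkℚᵘ (+ (2 * suc d ∸ p)) d
toℚᵘ-2- r p d r≃p/q p≤2q = begin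
  toℚᵘ (+ 2 / 1 - r)                     ≈⟨ toℚᵘ-homo-+ (+ 2 / 1) (-ℚ r) ⟩
  toℚᵘ (+ 2 / 1) +ᵘ toℚᵘ (-ℚ r)
    ≈⟨ ℚᵘ.+-cong (ℚᵘ.≃-reflexive (toℚᵘ-fromℕ 2)) (ℚᵘ.≃-trans (toℚᵘ-homo‿- r) (ℚᵘ.-‿cong r≃p/q)) ⟩
  mkℚᵘ (+ 2) 0 +ᵘ -ᵘ mkℚᵘ (+ p) d
    ≈⟨ *≡* (cong₂ ℤ._*_ numerator (cong (λ n → + suc n) (sym (+-identityʳ d)))) ⟩
  mkℚᵘ (+ (2 * suc d ∸ p)) d ∎
  where
  open ℚᵘ.≃-Reasoning
  numerator : + 2 ℤ.* + suc d ℤ.+ ℤ.- (+ p) ℤ.* + 1 ≡ + (2 * suc d ∸ p)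
  numerator = trans (cong (ℤ._+_ (+ (2 * suc d))) (ℤ.*-identityʳ (ℤ.- (+ p))))
    (trans (ℤ.m-n≡m⊖n (2 * suc d) p) (ℤ.⊖-≥ p≤2q))

ℕ⇒ℚ-bound : ∀ k t a b →
  (∀ p q → 1 ≤ q → q ≤ p → p ≤ 2 * q → 32 * k * (q * q) ≤ t * ((2 * q ∸ p) * (2 * q ∸ p)) →
     a * p ^ k ≤ b * q ^ k) →
  (r : ℚ) → 1ℚ ≤ℚ r → r ≤ℚ (+ 2 / 1) → (+ (32 * k) / 1) ≤ℚ ((+ t / 1) *ℚ ((+ 2 / 1 - r) *ℚ (+ 2 / 1 - r))) →
  ((+ a / 1) *ℚ (r ^ℚ k)) ≤ℚ (+ b / 1)
ℕ⇒ℚ-bound k t a b bound (mkℚ (ℤ.-[1+ _ ]) _ _) 1≤r _ _ with toℚᵘ-mono-≤ 1≤r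
... | *≤* ()
ℕ⇒ℚ-bound k t a b bound r@(mkℚ (+ p) d _) 1≤r r≤2 32k≤t[2-r]² = toℚᵘ-cancel-≤ (begin
  toℚᵘ ((+ a / 1) *ℚ (r ^ℚ k))                     ≃⟨ toℚᵘ-homo-* (+ a / 1) (r ^ℚ k) ⟩
  toℚᵘ (+ a / 1) *ᵘ toℚᵘ (r ^ℚ k)
    ≃⟨ ℚᵘ.*-cong (ℚᵘ.≃-reflexive (toℚᵘ-fromℕ a)) (toℚᵘ-^ r p d ℚᵘ.≃-refl k) ⟩
  mkℚᵘ (+ a) 0 *ᵘ mkℚᵘ (+ (p ^ k)) (pred (q ^ k))  ≃⟨ mkℚᵘ-* a 0 (p ^ k) (pred (q ^ k)) ⟩
  mkℚᵘ (+ (a * p ^ k)) (pred (q ^ k) + 0)          ≤⟨ mkℚᵘ-≤⁺ (a * p ^ k) _ b 0 ap^k≤bq^k ⟩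
  mkℚᵘ (+ b) 0                                     ≡⟨ toℚᵘ-fromℕ b ⟨
  toℚᵘ (+ b / 1) ∎)
  where
  open ℚᵘ.≤-Reasoning
  q = suc d
  e = 2 * q ∸ p
  instance _ = m^n≢0 q k
  q≤p : q ≤ p
  q≤p = subst₂ _≤_ (+-identityʳ q) (*-identityʳ p) (mkℚᵘ-≤⁻ 1 0 p d (toℚᵘ-mono-≤ 1≤r))
  p≤2q : p ≤ 2 * q
  p≤2q = subst (_≤ 2 * q) (*-identityʳ p)
    (mkℚᵘ-≤⁻ p d 2 0 (subst (mkℚᵘ (+ p) d ≤ᵘ_) (toℚᵘ-fromℕ 2) (toℚᵘ-mono-≤ r≤2)))
  2-r≃e/q : toℚᵘ (+ 2 / 1 - r) ≃ᵘ mkℚᵘ (+ e) d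
  2-r≃e/q = toℚᵘ-2- r p d ℚᵘ.≃-refl p≤2q
  t[2-r]²≃te²/q² :
    toℚᵘ ((+ t / 1) *ℚ ((+ 2 / 1 - r) *ℚ (+ 2 / 1 - r))) ≃ᵘ mkℚᵘ (+ (t * (e * e))) (d + d * q + 0)
  t[2-r]²≃te²/q² = begin-equality
    toℚᵘ ((+ t / 1) *ℚ ((+ 2 / 1 - r) *ℚ (+ 2 / 1 - r)))
      ≃⟨ toℚᵘ-homo-* (+ t / 1) _ ⟩
    toℚᵘ (+ t / 1) *ᵘ toℚᵘ ((+ 2 / 1 - r) *ℚ (+ 2 / 1 - r))
      ≃⟨ ℚᵘ.*-cong (ℚᵘ.≃-reflexive (toℚᵘ-fromℕ t)) (toℚᵘ-homo-* (+ 2 / 1 - r) (+ 2 / 1 - r)) ⟩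
    mkℚᵘ (+ t) 0 *ᵘ (toℚᵘ (+ 2 / 1 - r) *ᵘ toℚᵘ (+ 2 / 1 - r))
      ≃⟨ ℚᵘ.*-congˡ {mkℚᵘ (+ t) 0} (ℚᵘ.*-cong 2-r≃e/q 2-r≃e/q) ⟩
    mkℚᵘ (+ t) 0 *ᵘ (mkℚᵘ (+ e) d *ᵘ mkℚᵘ (+ e) d)
      ≃⟨ ℚᵘ.*-congˡ {mkℚᵘ (+ t) 0} (mkℚᵘ-* e d e d) ⟩
    mkℚᵘ (+ t) 0 *ᵘ mkℚᵘ (+ (e * e)) (d + d * q)
      ≃⟨ mkℚᵘ-* t 0 (e * e) (d + d * q) ⟩
    mkℚᵘ (+ (t * (e * e))) (d + d * q + 0) ∎
  32kq²≤te² : 32 * k * (q * q) ≤ t * (e * e)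
  32kq²≤te² = subst₂ _≤_ (cong (λ n → 32 * k * suc n) (+-identityʳ (d + d * q))) (*-identityʳ _)
    (mkℚᵘ-≤⁻ (32 * k) 0 (t * (e * e)) _
      (ℚᵘ.≤-respʳ-≃ t[2-r]²≃te²/q² (subst (_≤ᵘ _) (toℚᵘ-fromℕ (32 * k)) (toℚᵘ-mono-≤ 32k≤t[2-r]²))))
  ap^k≤bq^k : a * p ^ k * 1 ≤ b * suc (pred (q ^ k) + 0)
  ap^k≤bq^k = subst₂ _≤_ (sym (*-identityʳ _))
    (cong (b *_) (trans (sym (suc-pred (q ^ k))) (cong suc (sym (+-identityʳ (pred (q ^ k)))))))
    (bound p q (s≤s z≤n) q≤p p≤2q 32kq²≤te²)

lemmaA2 : (k t : ℕ) → 1 ≤ k → k < t →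
    ((t Data.Nat.∸ 1) C k ≤ Cstar t k)
    × ((r : ℚ) → 1ℚ ≤ℚ r → r ≤ℚ (+ 2 / 1) →
       (+ (32 * k) / 1) ≤ℚ ((+ t / 1) *ℚ ((+ 2 / 1 - r) *ℚ (+ 2 / 1 - r))) →
       ((+ ((t Data.Nat.∸ 1) C k) / 1) *ℚ (r ^ℚ k)) ≤ℚ (+ Cstar t k / 1))
lemmaA2 k t 1≤k k<t =
  [t∸1]Ck≤Cstar k t 1≤k k<t , ℕ⇒ℚ-bound k t ((t ∸ 1) C k) (Cstar t k) ([t∸1]Ck*p^k≤Cstar*q^k k t 1≤k k<t)
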